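{- For all $n\ge 3$, $d(n,2n)=\frac12\binom{2n}{n}$.
   Context: For a finite set $A$ of positive integers, write $\sum A$ for the sum of its elements. A subset $B\subseteq A$ is a divisor of $A$ if $\sum B$ divides $\sum A$. $d_k(A)$ is the number of $k$-element subsets of $A$ that are divisors of $A$, and $d(k,m)$ is the maximum of $d_k(A)$ over all sets $A$ of $m$ positive integers. -}

module Defs where

open import Data.Nat using (ℕ; zero; suc; _+_; _*_; _<_; _≟_)
open import Data.Nat.Divisibility using (_∣_; _∣?_)
open import Data.Bool using (Bool; true; false)
open import Data.Vec using (Vec; []; _∷_)
open import Data.List using (List; []; _∷_; map; _++_; filter; length)
open import Data.Fin using (Fin)
open import Data.Fin.Subset using (Subset; ∣_∣; inside; outside)
open import Data.Product using (_×_)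
open import Relation.Nullary.Decidable using (_×-dec_)
open import Relation.Binary.PropositionalEquality using (_≡_; _≢_)
open import Function.Definitions using (Injective)

-- A finite set A of m positive integers, given as an injective
-- enumeration  a : Fin m → ℕ  with all values positive.
IsPosSet : (m : ℕ) → (Fin m → ℕ) → Set
IsPosSet m a = Injective _≡_ _≡_ a × (∀ i → 0 < a i)

subsetSum : {m : ℕ} → (Fin m → ℕ) → Subset m → ℕ
subsetSum {zero} a [] = 0
subsetSum {suc m} a (true ∷ s) = a Fin.zero + subsetSum (λ i → a (Fin.suc i)) s
subsetSum {suc m} a (false ∷ s) = subsetSum (λ i → a (Fin.suc i)) s

total : {m : ℕ} → (Fin m → ℕ) → ℕ
total {zero} a = 0
total {suc m} a = a Fin.zero + total (λ i → a (Fin.suc i))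

allSubsets : (m : ℕ) → List (Subset m)
allSubsets zero = [] ∷ []
allSubsets (suc m) = map (inside ∷_) (allSubsets m) ++ map (outside ∷_) (allSubsets m)

dk : (k : ℕ) {m : ℕ} → (Fin m → ℕ) → ℕ
dk k {m} a = length (filter (λ s → (∣ s ∣ ≟ k) ×-dec (subsetSum a s ∣? total a)) (allSubsets m))

-- Pair each n-subset B of A with its complement: as ΣB + Σ∁B = ΣA, both divide ΣA only if
-- ΣB = ΣA/2. So d_n(A) ≤ ½·C(2n,n) follows once there are no more balanced sets (ΣB = ΣA/2) than
-- sets B for which neither B nor ∁B divides ΣA. A balanced B is sent to such a set by exchanging
-- the first pair of consecutive elements of A (consecutive in value) that lie on different sides
-- and differ by less than ΣA/6: the exchange moves ΣB by the gap g, and the parts ΣA/2 ± g are too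
-- close for either to divide ΣA. Such a pair exists because n ≥ 3, and the rule for choosing it
-- makes the exchange recoverable from its image. Equality holds for {1, …, 2n−1, M} with M chosen
-- so that ΣA = (2b+1)! where b = 1 + ⋯ + (2n−1): exactly the n-subsets avoiding M divide ΣA.

module Submission where

open import Defs
open import Data.Bool using (Bool; true; false; not; if_then_else_)
open import Data.Bool.Properties using (not-injective; not-¬)
import Data.Bool.Properties as Bool
open import Data.Empty using (⊥)
open import Data.Fin using (Fin; zero; suc; fromℕ<; toℕ)
open import Data.Fin.Properties using (any?; all?)
import Data.Fin.Properties as Fin
open import Data.Fin.Subset using (Subset; inside; outside; ∣_∣; ∁)
open import Data.List using (List; []; _∷_; length; filter; map; _++_)
open import Data.List.Properties using (length-++; filter-++)
open import Data.Nat using (ℕ; zero; suc; _+_; _*_; _∸_; _/_; _!; _≤_; _<_; _≟_; _≤?_; _<?_; z≤n; s≤s; s≤s⁻¹; z<s)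
open import Data.Nat.Combinatorics using (_C_; nCk+nC[k+1]≡[n+1]C[k+1]; nCk≡nC[n∸k])
open import Data.Nat.Divisibility
  using (_∣_; _∣?_; divides; ∣-antisym; ∣-refl; ∣-trans; ∣m+n∣m⇒∣n; ∣⇒≤; m∣m*n; m≤n⇒m!∣n!)
open import Data.Nat.DivMod using (m*n/n≡m; /-monoˡ-≤)
open import Data.Nat.Properties
open import Data.Nat.Tactic.RingSolver using (solve-∀)
open import Data.Product using (Σ; _×_; _,_; proj₁; proj₂; ∃; swap)
open import Data.Sum using (_⊎_; inj₁; inj₂; reduce)
open import Data.Unit using (⊤; tt)
open import Data.Vec using ([]; _∷_; lookup; _[_]≔_)
open import Data.Vec.Properties using (lookup∘update; lookup∘update′; lookup-map)
open import Function using (_∘_)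
open import Level using (0ℓ)
open import Relation.Binary.Core using (Rel)
open import Relation.Binary.Definitions using (Total; Transitive; tri<; tri≈; tri>)
open import Relation.Binary.PropositionalEquality
open import Relation.Nullary using (Dec; yes; no; does; ¬_; contradiction; ¬?; _×-dec_; _→-dec_)
open import Relation.Unary using (Decidable)

open import Algebra.Properties.CommutativeSemigroup +-commutativeSemigroup using (interchange; x∙yz≈y∙xz)

private
  variable
    k m : ℕ
    A : Set
    P : Set

+-interchange : ∀ w x y z → (w + x) + (y + z) ≡ (w + y) + (x + z)
+-interchange = interchange

m+i≡n+j⇒m≡n+[j∸i] : ∀ {m n i j} → m + i ≡ n + j → i ≤ j → m ≡ n + (j ∸ i)
m+i≡n+j⇒m≡n+[j∸i] {m} {n} {i} {j} m+i≡n+j i≤j = +-cancelʳ-≡ i m (n + (j ∸ i)) (begin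
  m + i             ≡⟨ m+i≡n+j ⟩
  n + j             ≡⟨ cong (n +_) (m∸n+n≡m i≤j) ⟨
  n + (j ∸ i + i)   ≡⟨ +-assoc n (j ∸ i) i ⟨
  n + (j ∸ i) + i   ∎)
  where open ≡-Reasoning

distinct-Bools : {b c : Bool} → b ≢ c → b ≡ true × c ≡ false ⊎ b ≡ false × c ≡ true
distinct-Bools {true}  {true}  b≢c = contradiction refl b≢c
distinct-Bools {true}  {false} _   = inj₁ (refl , refl)
distinct-Bools {false} {true}  _   = inj₂ (refl , refl)
distinct-Bools {false} {false} b≢c = contradiction refl b≢c

𝟙 : Dec P → ℕ
𝟙 P? = if does P? then 1 else 0

𝟙≤1 : (P? : Dec P) → 𝟙 P? ≤ 1
𝟙≤1 (yes _) = s≤s z≤n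
𝟙≤1 (no _)  = z≤n

𝟙-yes : (P? : Dec P) → P → 𝟙 P? ≡ 1
𝟙-yes (yes _) _  = refl
𝟙-yes (no ¬p) p = contradiction p ¬p

𝟙-no : (P? : Dec P) → ¬ P → 𝟙 P? ≡ 0
𝟙-no (yes p) ¬p = contradiction p ¬p
𝟙-no (no _)  _  = refl

𝟙-witness : (P? : Dec P) → 1 ≤ 𝟙 P? → P
𝟙-witness (yes p) _ = p

𝟙-≤ : ∀ {n} (P? : Dec P) → (P → 1 ≤ n) → 𝟙 P? ≤ n
𝟙-≤ (yes p) 1≤n = 1≤n p
𝟙-≤ (no _)  _   = z≤n

𝟙-×-yes : {B : Set} (P? : Dec P) (B? : Dec B) → P → 𝟙 (P? ×-dec B?) ≡ 𝟙 B?
𝟙-×-yes (yes _) B? _ = refl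
𝟙-×-yes (no ¬p) B? p = contradiction p ¬p

𝟙-×-no : {B : Set} (P? : Dec P) (B? : Dec B) → ¬ P → 𝟙 (P? ×-dec B?) ≡ 0
𝟙-×-no (yes p) B? ¬p = contradiction p ¬p
𝟙-×-no (no _)  B? _  = refl

𝟙-×-implied : {B : Set} (P? : Dec P) (B? : Dec B) → (P → B) → 𝟙 (P? ×-dec B?) ≡ 𝟙 P?
𝟙-×-implied (yes p) B? P→B = 𝟙-yes B? (P→B p)
𝟙-×-implied (no _)  B? _   = refl

𝟙-pair-bound : {B C E : Set} (B? : Dec B) (C? : Dec C) (E? : Dec E) → (B → C → E) →
  𝟙 B? + 𝟙 C? + 𝟙 (¬? B? ×-dec ¬? C?) ≤ 1 + 𝟙 E?
𝟙-pair-bound (yes b) (yes c) E? b→c→e = ≤-reflexive (cong suc (sym (𝟙-yes E? (b→c→e b c))))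
𝟙-pair-bound (yes _) (no _)  _  _     = s≤s z≤n
𝟙-pair-bound (no _)  (yes _) _  _     = s≤s z≤n
𝟙-pair-bound (no _)  (no _)  _  _     = s≤s z≤n

total-cong : {f g : Fin m → ℕ} → (∀ i → f i ≡ g i) → total f ≡ total g
total-cong {zero}  _   = refl
total-cong {suc m} f≗g = cong₂ _+_ (f≗g zero) (total-cong (f≗g ∘ suc))

term≤total : (f : Fin m → ℕ) (i : Fin m) → f i ≤ total f
term≤total f zero    = m≤m+n (f zero) _
term≤total f (suc i) = ≤-trans (term≤total (f ∘ suc) i) (m≤n+m _ (f zero))

total-positive : (f : Fin m → ℕ) → 1 ≤ total f → ∃ λ i → 1 ≤ f i
total-positive {suc m} f 1≤total with 1 ≤? f zero
... | yes 1≤f₀ = zero , 1≤f₀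
... | no 1≰f₀  with total-positive (f ∘ suc) (subst (λ v → 1 ≤ v + total (f ∘ suc)) (n≤0⇒n≡0 (≮⇒≥ 1≰f₀)) 1≤total)
...   | i , 1≤fᵢ = suc i , 1≤fᵢ

total-≤1 : (f : Fin m → ℕ) → (∀ i → f i ≤ 1) → (∀ i j → 1 ≤ f i → 1 ≤ f j → i ≡ j) → total f ≤ 1
total-≤1 {zero}  f _   _      = z≤n
total-≤1 {suc m} f f≤1 unique with 1 ≤? f zero
... | yes 1≤f₀ = +-mono-≤ (f≤1 zero) (≮⇒≥ tail-empty)
  where
  tail-empty : ¬ 1 ≤ total (f ∘ suc)
  tail-empty 1≤tail with total-positive (f ∘ suc) 1≤tail
  ... | i , 1≤fᵢ with () ← unique zero (suc i) 1≤f₀ 1≤fᵢ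
... | no 1≰f₀ = +-mono-≤ (≮⇒≥ 1≰f₀)
                  (total-≤1 (f ∘ suc) (f≤1 ∘ suc) (λ i j p q → Fin.suc-injective (unique (suc i) (suc j) p q)))

refl-of-total : {_≼_ : Rel A 0ℓ} → Total _≼_ → ∀ x → x ≼ x
refl-of-total total x = reduce (total x x)

least : {P : Fin m → Set} (_≼_ : Rel (Fin m) 0ℓ) → Total _≼_ → Transitive _≼_ →
  Decidable P → ∃ P → ∃ λ i → P i × ∀ j → P j → i ≼ j
least {zero}  _   _     _     _  (() , _)
least {suc m} {P} _≼_ total trans P? (i , Pᵢ) with P? zero | any? (P? ∘ suc)
... | no ¬P₀ | no ¬Pₛ = contradiction Pᵢ (none i)
  where
  none : ∀ k → ¬ P k
  none zero    = ¬P₀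
  none (suc k) = ¬Pₛ ∘ (k ,_)
... | yes P₀ | no ¬Pₛ = zero , P₀ , λ where zero _ → refl-of-total total zero ; (suc j) Pⱼ → contradiction (j , Pⱼ) ¬Pₛ
... | P₀? | yes ∃Pₛ with least (λ j k → suc j ≼ suc k) (λ j k → total (suc j) (suc k)) trans (P? ∘ suc) ∃Pₛ
...   | j , Pⱼ , j-least with P₀? 
...     | no ¬P₀ = suc j , Pⱼ , λ where zero P₀ → contradiction P₀ ¬P₀ ; (suc k) Pₖ → j-least k Pₖ
...     | yes P₀ with total zero (suc j)
...       | inj₁ 0≼j = zero , P₀ , λ where zero _ → refl-of-total total zero ; (suc k) Pₖ → trans 0≼j (j-least k Pₖ)
...       | inj₂ j≼0 = suc j , Pⱼ , λ where zero _ → j≼0 ; (suc k) Pₖ → j-least k Pₖ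

-- Sums over all subsets of Fin m

∑℘ : (Subset m → ℕ) → ℕ
∑℘ {zero}  f = f []
∑℘ {suc m} f = ∑℘ (λ s → f (inside ∷ s)) + ∑℘ (λ s → f (outside ∷ s))

length-filter-allSubsets : {P : Subset m → Set} (P? : Decidable P) →
  length (filter P? (allSubsets m)) ≡ ∑℘ (λ s → 𝟙 (P? s))
length-filter-allSubsets {zero}  P? with P? []
... | yes _ = refl
... | no _  = refl
length-filter-allSubsets {suc m} P? = begin
  length (filter P? (map (inside ∷_) S ++ map (outside ∷_) S))
    ≡⟨ cong length (filter-++ P? (map (inside ∷_) S) _) ⟩
  length (filter P? (map (inside ∷_) S) ++ filter P? (map (outside ∷_) S))
    ≡⟨ length-++ (filter P? (map (inside ∷_) S)) ⟩
  length (filter P? (map (inside ∷_) S)) + length (filter P? (map (outside ∷_) S))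
    ≡⟨ cong₂ _+_ (length-filter-map (inside ∷_) S) (length-filter-map (outside ∷_) S) ⟩
  length (filter (λ s → P? (inside ∷ s)) S) + length (filter (λ s → P? (outside ∷ s)) S)
    ≡⟨ cong₂ _+_ (length-filter-allSubsets (λ s → P? (inside ∷ s)))
                 (length-filter-allSubsets (λ s → P? (outside ∷ s))) ⟩
  ∑℘ (λ s → 𝟙 (P? s)) ∎
  where
  open ≡-Reasoning
  S = allSubsets m
  length-filter-map : (f : Subset m → Subset (suc m)) (xs : List (Subset m)) →
    length (filter P? (map f xs)) ≡ length (filter (P? ∘ f) xs)
  length-filter-map f []       = refl
  length-filter-map f (x ∷ xs) with does (P? (f x))
  ... | true  = cong suc (length-filter-map f xs)
  ... | false = length-filter-map f xs

∑℘-cong : {f g : Subset m → ℕ} → (∀ s → f s ≡ g s) → ∑℘ f ≡ ∑℘ g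
∑℘-cong {zero}  f≗g = f≗g []
∑℘-cong {suc m} f≗g = cong₂ _+_ (∑℘-cong (λ s → f≗g (inside ∷ s))) (∑℘-cong (λ s → f≗g (outside ∷ s)))

∑℘-mono-≤ : {f g : Subset m → ℕ} → (∀ s → f s ≤ g s) → ∑℘ f ≤ ∑℘ g
∑℘-mono-≤ {zero}  f≤g = f≤g []
∑℘-mono-≤ {suc m} f≤g = +-mono-≤ (∑℘-mono-≤ (λ s → f≤g (inside ∷ s))) (∑℘-mono-≤ (λ s → f≤g (outside ∷ s)))

∑℘-zero : ∀ m → ∑℘ {m} (λ _ → 0) ≡ 0
∑℘-zero zero    = refl
∑℘-zero (suc m) = cong₂ _+_ (∑℘-zero m) (∑℘-zero m)

∑℘-distrib-+ : (f g : Subset m → ℕ) → ∑℘ (λ s → f s + g s) ≡ ∑℘ f + ∑℘ g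
∑℘-distrib-+ {zero}  f g = refl
∑℘-distrib-+ {suc m} f g = trans
  (cong₂ _+_ (∑℘-distrib-+ (λ s → f (inside ∷ s)) (λ s → g (inside ∷ s)))
             (∑℘-distrib-+ (λ s → f (outside ∷ s)) (λ s → g (outside ∷ s))))
  (+-interchange (∑℘ (λ s → f (inside ∷ s))) _ _ _)

∑℘-total : (f : Fin k → Subset m → ℕ) → ∑℘ (λ s → total (λ i → f i s)) ≡ total (λ i → ∑℘ (f i))
∑℘-total {zero}  {m} f = ∑℘-zero m
∑℘-total {suc k}     f = trans (∑℘-distrib-+ (f zero) (λ s → total (λ i → f (suc i) s)))
                               (cong (∑℘ (f zero) +_) (∑℘-total (f ∘ suc)))

∑℘-∘∁ : (f : Subset m → ℕ) → ∑℘ (f ∘ ∁) ≡ ∑℘ f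
∑℘-∘∁ {zero}  f = refl
∑℘-∘∁ {suc m} f = trans (cong₂ _+_ (∑℘-∘∁ (λ s → f (outside ∷ s))) (∑℘-∘∁ (λ s → f (inside ∷ s))))
                        (+-comm (∑℘ (λ s → f (outside ∷ s))) _)

∑℘-card : ∀ m k → ∑℘ {m} (λ s → 𝟙 (∣ s ∣ ≟ k)) ≡ m C k
∑℘-card zero    zero    = refl
∑℘-card zero    (suc k) = refl
∑℘-card (suc m) zero    = cong₂ _+_ (∑℘-zero m) (∑℘-card m zero)
∑℘-card (suc m) (suc k) = trans (cong₂ _+_ (∑℘-card m k) (∑℘-card m (suc k))) (nCk+nC[k+1]≡[n+1]C[k+1] m k)

subsetSum-∁ : (w : Fin m → ℕ) (s : Subset m) → subsetSum w s + subsetSum w (∁ s) ≡ total w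
subsetSum-∁ w []          = refl
subsetSum-∁ w (true ∷ s)  = trans (+-assoc (w zero) _ _) (cong (w zero +_) (subsetSum-∁ (w ∘ suc) s))
subsetSum-∁ w (false ∷ s) = begin
  σ s + (w zero + σ (∁ s))   ≡⟨ x∙yz≈y∙xz (σ s) (w zero) (σ (∁ s)) ⟩
  w zero + (σ s + σ (∁ s))   ≡⟨ cong (w zero +_) (subsetSum-∁ (w ∘ suc) s) ⟩
  w zero + total (w ∘ suc)   ∎
  where
  open ≡-Reasoning
  σ = subsetSum (w ∘ suc)

subsetSum≤total : (w : Fin m → ℕ) (s : Subset m) → subsetSum w s ≤ total w
subsetSum≤total w s = subst (subsetSum w s ≤_) (subsetSum-∁ w s) (m≤m+n _ _)

∣∣*≤subsetSum : (w : Fin m → ℕ) (s : Subset m) {v : ℕ} →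
  (∀ j → lookup s j ≡ inside → v ≤ w j) → ∣ s ∣ * v ≤ subsetSum w s
∣∣*≤subsetSum w []          _     = z≤n
∣∣*≤subsetSum w (true ∷ s)  v≤s   = +-mono-≤ (v≤s zero refl) (∣∣*≤subsetSum (w ∘ suc) s (v≤s ∘ suc))
∣∣*≤subsetSum w (false ∷ s) v≤s   = ∣∣*≤subsetSum (w ∘ suc) s (v≤s ∘ suc)

∣∣+∣∁∣ : (s : Subset m) → ∣ s ∣ + ∣ ∁ s ∣ ≡ m
∣∣+∣∁∣ []          = refl
∣∣+∣∁∣ (true ∷ s)  = cong suc (∣∣+∣∁∣ s)
∣∣+∣∁∣ (false ∷ s) = trans (+-suc ∣ s ∣ _) (cong suc (∣∣+∣∁∣ s))

∣∣-constant : (s : Subset m) (b : Bool) → (∀ j → lookup s j ≡ b) → ∣ s ∣ ≡ (if b then m else 0)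
∣∣-constant []          true  _ = refl
∣∣-constant []          false _ = refl
∣∣-constant (true ∷ s)  true  s≡b = cong suc (∣∣-constant s true (s≡b ∘ suc))
∣∣-constant (false ∷ s) false s≡b = ∣∣-constant s false (s≡b ∘ suc)
∣∣-constant (true ∷ s)  false s≡b with () ← s≡b zero
∣∣-constant (false ∷ s) true  s≡b with () ← s≡b zero

∣∣≡subsetSum-1 : (s : Subset m) → ∣ s ∣ ≡ subsetSum (λ _ → 1) s
∣∣≡subsetSum-1 []          = refl
∣∣≡subsetSum-1 (true ∷ s)  = cong suc (∣∣≡subsetSum-1 s)
∣∣≡subsetSum-1 (false ∷ s) = ∣∣≡subsetSum-1 s

-- Exchanging the memberships of two elements

infixl 6 _[_⇄_]
_[_⇄_] : Subset m → Fin m → Fin m → Subset m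
s [ x ⇄ y ] = (s [ x ]≔ lookup s y) [ y ]≔ lookup s x

⇄-lookupˡ : (s : Subset m) {x y : Fin m} → x ≢ y → lookup (s [ x ⇄ y ]) x ≡ lookup s y
⇄-lookupˡ s {x} {y} x≢y = trans (lookup∘update′ x≢y (s [ x ]≔ lookup s y) (lookup s x)) (lookup∘update x s (lookup s y))

⇄-lookupʳ : (s : Subset m) (x y : Fin m) → lookup (s [ x ⇄ y ]) y ≡ lookup s x
⇄-lookupʳ s x y = lookup∘update y (s [ x ]≔ lookup s y) (lookup s x)

⇄-lookup-other : (s : Subset m) {x y z : Fin m} → z ≢ x → z ≢ y → lookup (s [ x ⇄ y ]) z ≡ lookup s z
⇄-lookup-other s {x} {y} z≢x z≢y =
  trans (lookup∘update′ z≢y (s [ x ]≔ lookup s y) (lookup s x)) (lookup∘update′ z≢x s (lookup s y))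

⇄-distinct : (s : Subset m) {x y : Fin m} → x ≢ y →
  lookup (s [ x ⇄ y ]) x ≢ lookup (s [ x ⇄ y ]) y → lookup s x ≢ lookup s y
⇄-distinct s {x} {y} x≢y differ sₓ≡sᵧ = differ (trans (⇄-lookupˡ s x≢y) (trans (sym sₓ≡sᵧ) (sym (⇄-lookupʳ s x y))))

-- (b , t) ↦ (lookup t y , t [ y ]≔ b) permutes Bool × Subset m: it is (b ∷ t) [ zero ⇄ suc y ].
∑℘-head⇄ : (y : Fin m) (g : Bool → Subset m → ℕ) →
  ∑℘ (λ t → g (lookup t y) (t [ y ]≔ inside)) + ∑℘ (λ t → g (lookup t y) (t [ y ]≔ outside))
  ≡ ∑℘ (g inside) + ∑℘ (g outside)
∑℘-head⇄ zero    g = +-interchange (∑℘ (λ t → g inside (inside ∷ t))) _ _ _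
∑℘-head⇄ (suc y) g = begin
  (P₁ + P₂) + (Q₁ + Q₂)                      ≡⟨ +-interchange P₁ P₂ Q₁ Q₂ ⟩
  (P₁ + Q₁) + (P₂ + Q₂)                      ≡⟨ cong₂ _+_ (∑℘-head⇄ y (λ b u → g b (inside ∷ u)))
                                                           (∑℘-head⇄ y (λ b u → g b (outside ∷ u))) ⟩
  (G inside inside + G outside inside) + (G inside outside + G outside outside)
                                             ≡⟨ +-interchange (G inside inside) _ _ _ ⟩
  (G inside inside + G inside outside) + (G outside inside + G outside outside) ∎
  where
  open ≡-Reasoning
  P₁ = ∑℘ (λ t → g (lookup t y) (inside ∷ (t [ y ]≔ inside)))
  P₂ = ∑℘ (λ t → g (lookup t y) (outside ∷ (t [ y ]≔ inside)))
  Q₁ = ∑℘ (λ t → g (lookup t y) (inside ∷ (t [ y ]≔ outside)))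
  Q₂ = ∑℘ (λ t → g (lookup t y) (outside ∷ (t [ y ]≔ outside)))
  G : Bool → Bool → ℕ
  G b c = ∑℘ (λ t → g b (c ∷ t))

∑℘-∘⇄ : (f : Subset m → ℕ) (x y : Fin m) → ∑℘ (λ s → f (s [ x ⇄ y ])) ≡ ∑℘ f
∑℘-∘⇄ f zero    zero    = refl
∑℘-∘⇄ f zero    (suc y) = ∑℘-head⇄ y (λ b t → f (b ∷ t))
∑℘-∘⇄ f (suc x) zero    = ∑℘-head⇄ x (λ b t → f (b ∷ t))
∑℘-∘⇄ f (suc x) (suc y) = cong₂ _+_ (∑℘-∘⇄ (λ t → f (inside ∷ t)) x y) (∑℘-∘⇄ (λ t → f (outside ∷ t)) x y)

contribution : Bool → ℕ → ℕ
contribution b v = if b then v else 0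

subsetSum-update : (w : Fin m → ℕ) (s : Subset m) (x : Fin m) (b : Bool) →
  subsetSum w (s [ x ]≔ b) + contribution (lookup s x) (w x) ≡ subsetSum w s + contribution b (w x)
subsetSum-update w (true ∷ s)  zero    true  = refl
subsetSum-update w (true ∷ s)  zero    false = trans (+-comm _ (w zero)) (sym (+-identityʳ _))
subsetSum-update w (false ∷ s) zero    true  = trans (+-identityʳ _) (+-comm (w zero) _)
subsetSum-update w (false ∷ s) zero    false = refl
subsetSum-update w (true ∷ s)  (suc x) b     = trans (+-assoc (w zero) _ _)
  (trans (cong (w zero +_) (subsetSum-update (w ∘ suc) s x b)) (sym (+-assoc (w zero) _ _)))
subsetSum-update w (false ∷ s) (suc x) b     = subsetSum-update (w ∘ suc) s x b

subsetSum-⇄ : (w : Fin m → ℕ) (s : Subset m) {x y : Fin m} → x ≢ y →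
  subsetSum w (s [ x ⇄ y ]) + (contribution (lookup s x) (w x) + contribution (lookup s y) (w y))
  ≡ subsetSum w s + (contribution (lookup s y) (w x) + contribution (lookup s x) (w y))
subsetSum-⇄ {m} w s {x} {y} x≢y = begin
  σ (s [ x ⇄ y ]) + (cₓ + c y (lookup s y))         ≡⟨ cong (σ (s [ x ⇄ y ]) +_) (+-comm cₓ _) ⟩
  σ (s [ x ⇄ y ]) + (c y (lookup s y) + cₓ)         ≡⟨ +-assoc (σ (s [ x ⇄ y ])) _ cₓ ⟨
  σ (s [ x ⇄ y ]) + c y (lookup s y) + cₓ           ≡⟨ cong (λ b → σ (s [ x ⇄ y ]) + c y b + cₓ) (sym uᵧ) ⟩
  σ (s [ x ⇄ y ]) + c y (lookup u y) + cₓ           ≡⟨ cong (_+ cₓ) (subsetSum-update w u y (lookup s x)) ⟩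
  σ u + c y (lookup s x) + cₓ                       ≡⟨ +-assoc (σ u) _ cₓ ⟩
  σ u + (c y (lookup s x) + cₓ)                     ≡⟨ cong (σ u +_) (+-comm _ cₓ) ⟩
  σ u + (cₓ + c y (lookup s x))                     ≡⟨ +-assoc (σ u) cₓ _ ⟨
  σ u + cₓ + c y (lookup s x)                       ≡⟨ cong (_+ c y (lookup s x)) (subsetSum-update w s x (lookup s y)) ⟩
  σ s + c x (lookup s y) + c y (lookup s x)         ≡⟨ +-assoc (σ s) _ _ ⟩
  σ s + (c x (lookup s y) + c y (lookup s x))       ∎
  where
  open ≡-Reasoning
  σ = subsetSum w
  c : Fin m → Bool → ℕ
  c i b = contribution b (w i)
  cₓ = c x (lookup s x)
  u = s [ x ]≔ lookup s y
  uᵧ : lookup u y ≡ lookup s y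
  uᵧ = lookup∘update′ (x≢y ∘ sym) s (lookup s y)

subsetSum-⇄-in-out : (w : Fin m → ℕ) (s : Subset m) {x y : Fin m} → x ≢ y →
  lookup s x ≡ inside → lookup s y ≡ outside → subsetSum w (s [ x ⇄ y ]) + w x ≡ subsetSum w s + w y
subsetSum-⇄-in-out w s {x} {y} x≢y sₓ sᵧ = begin
  subsetSum w (s [ x ⇄ y ]) + w x
    ≡⟨ cong (subsetSum w (s [ x ⇄ y ]) +_) (+-identityʳ (w x)) ⟨
  subsetSum w (s [ x ⇄ y ]) + (contribution inside (w x) + contribution outside (w y))
    ≡⟨ cong₂ (λ b c → subsetSum w (s [ x ⇄ y ]) + (contribution b (w x) + contribution c (w y))) sₓ sᵧ ⟨
  subsetSum w (s [ x ⇄ y ]) + (contribution (lookup s x) (w x) + contribution (lookup s y) (w y))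
    ≡⟨ subsetSum-⇄ w s x≢y ⟩
  subsetSum w s + (contribution (lookup s y) (w x) + contribution (lookup s x) (w y))
    ≡⟨ cong₂ (λ b c → subsetSum w s + (contribution b (w x) + contribution c (w y))) sᵧ sₓ ⟩
  subsetSum w s + w y ∎
  where open ≡-Reasoning

subsetSum-⇄-out-in : (w : Fin m → ℕ) (s : Subset m) {x y : Fin m} → x ≢ y →
  lookup s x ≡ outside → lookup s y ≡ inside → subsetSum w (s [ x ⇄ y ]) + w y ≡ subsetSum w s + w x
subsetSum-⇄-out-in w s {x} {y} x≢y sₓ sᵧ = begin
  subsetSum w (s [ x ⇄ y ]) + (contribution outside (w x) + contribution inside (w y))
    ≡⟨ cong₂ (λ b c → subsetSum w (s [ x ⇄ y ]) + (contribution b (w x) + contribution c (w y))) sₓ sᵧ ⟨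
  subsetSum w (s [ x ⇄ y ]) + (contribution (lookup s x) (w x) + contribution (lookup s y) (w y))
    ≡⟨ subsetSum-⇄ w s x≢y ⟩
  subsetSum w s + (contribution (lookup s y) (w x) + contribution (lookup s x) (w y))
    ≡⟨ cong₂ (λ b c → subsetSum w s + (contribution b (w x) + contribution c (w y))) sᵧ sₓ ⟩
  subsetSum w s + (w x + 0)
    ≡⟨ cong (subsetSum w s +_) (+-identityʳ (w x)) ⟩
  subsetSum w s + w x ∎
  where open ≡-Reasoning

subsetSum-⇄-shift : (w : Fin m → ℕ) (s : Subset m) {x y : Fin m} → x ≢ y → w x ≤ w y →
  lookup s x ≢ lookup s y →
  subsetSum w (s [ x ⇄ y ]) ≡ subsetSum w s + (w y ∸ w x) ⊎ subsetSum w s ≡ subsetSum w (s [ x ⇄ y ]) + (w y ∸ w x)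
subsetSum-⇄-shift w s x≢y wₓ≤wᵧ sₓ≢sᵧ with distinct-Bools sₓ≢sᵧ
... | inj₁ (sₓ , sᵧ) = inj₁ (m+i≡n+j⇒m≡n+[j∸i] (subsetSum-⇄-in-out w s x≢y sₓ sᵧ) wₓ≤wᵧ)
... | inj₂ (sₓ , sᵧ) = inj₂ (m+i≡n+j⇒m≡n+[j∸i] (sym (subsetSum-⇄-out-in w s x≢y sₓ sᵧ)) wₓ≤wᵧ)

subsetSum-⇄-chain : (w : Fin m → ℕ) (s : Subset m) {x y z : Fin m} → x ≢ y → y ≢ z →
  lookup s x ≢ lookup s y → lookup s y ≢ lookup s z →
  subsetSum w (s [ x ⇄ y ]) ≡ subsetSum w (s [ y ⇄ z ]) → w x ≡ w z
subsetSum-⇄-chain w s {x} {y} {z} x≢y y≢z sx≢sy sy≢sz σ₁≡σ₂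
  with distinct-Bools sx≢sy | distinct-Bools sy≢sz
... | inj₁ (sₓ , sᵧ) | inj₂ (sᵧ′ , sz) = +-cancelˡ-≡ (subsetSum w (s [ x ⇄ y ])) (w x) (w z) (begin
  subsetSum w (s [ x ⇄ y ]) + w x   ≡⟨ subsetSum-⇄-in-out w s x≢y sₓ sᵧ ⟩
  subsetSum w s + w y               ≡⟨ subsetSum-⇄-out-in w s y≢z sᵧ′ sz ⟨
  subsetSum w (s [ y ⇄ z ]) + w z   ≡⟨ cong (_+ w z) σ₁≡σ₂ ⟨
  subsetSum w (s [ x ⇄ y ]) + w z   ∎)
  where open ≡-Reasoning
... | inj₂ (sₓ , sᵧ) | inj₁ (sᵧ′ , sz) = +-cancelˡ-≡ (subsetSum w s) (w x) (w z) (begin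
  subsetSum w s + w x               ≡⟨ subsetSum-⇄-out-in w s x≢y sₓ sᵧ ⟨
  subsetSum w (s [ x ⇄ y ]) + w y   ≡⟨ cong (_+ w y) σ₁≡σ₂ ⟩
  subsetSum w (s [ y ⇄ z ]) + w y   ≡⟨ subsetSum-⇄-in-out w s y≢z sᵧ′ sz ⟩
  subsetSum w s + w z               ∎)
  where open ≡-Reasoning
... | inj₁ (_ , sᵧ) | inj₁ (sᵧ′ , _) = contradiction (trans (sym sᵧ) sᵧ′) λ ()
... | inj₂ (_ , sᵧ) | inj₂ (sᵧ′ , _) = contradiction (trans (sym sᵧ) sᵧ′) λ ()

∣⇄∣ : (s : Subset m) {x y : Fin m} → x ≢ y → ∣ s [ x ⇄ y ] ∣ ≡ ∣ s ∣
∣⇄∣ s {x} {y} x≢y = begin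
  ∣ s [ x ⇄ y ] ∣                    ≡⟨ ∣∣≡subsetSum-1 (s [ x ⇄ y ]) ⟩
  subsetSum (λ _ → 1) (s [ x ⇄ y ])  ≡⟨ +-cancelʳ-≡ (c (lookup s x) + c (lookup s y)) _ _ (trans
                                          (subsetSum-⇄ (λ _ → 1) s x≢y)
                                          (cong (subsetSum (λ _ → 1) s +_) (+-comm (c (lookup s y)) _))) ⟩
  subsetSum (λ _ → 1) s              ≡⟨ ∣∣≡subsetSum-1 s ⟨
  ∣ s ∣                              ∎
  where
  open ≡-Reasoning
  c : Bool → ℕ
  c b = contribution b 1

-- s ↦ s [ x ⇄ y ], for the pair (x , y) that W attaches to s, injects P into R: an exchange
-- undoes itself, so injectivity amounts to W determining the pair from the image.
∑℘-≤-via-⇄ : {P R : Subset m → Set} {W : Fin m → Fin m → Subset m → Set} →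
  (P? : Decidable P) (R? : Decidable R) (W? : ∀ x y → Decidable (W x y)) →
  (∀ {s} → P s → ∃ λ x → ∃ λ y → W x y s) →
  (∀ {t x y} → W x y (t [ x ⇄ y ]) → R t) →
  (∀ {t x y x′ y′} → W x y (t [ x ⇄ y ]) → W x′ y′ (t [ x′ ⇄ y′ ]) → x ≡ x′ × y ≡ y′) →
  ∑℘ (λ s → 𝟙 (P? s)) ≤ ∑℘ (λ t → 𝟙 (R? t))
∑℘-≤-via-⇄ {m} {W = W} P? R? W? witness W⇒R W-unique = begin
  ∑℘ (λ s → 𝟙 (P? s))                                       ≤⟨ ∑℘-mono-≤ P≤pairs ⟩
  ∑℘ (λ s → total (λ x → total (λ y → 𝟙 (W? x y s))))        ≡⟨ ∑℘-total₂ (λ x y s → 𝟙 (W? x y s)) ⟩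
  total (λ x → total (λ y → ∑℘ (λ s → 𝟙 (W? x y s))))        ≡⟨ total-cong (λ x → total-cong (λ y →
                                                                  ∑℘-∘⇄ (λ s → 𝟙 (W? x y s)) x y)) ⟨
  total (λ x → total (λ y → ∑℘ (λ t → 𝟙 (W? x y (t [ x ⇄ y ])))))
                                                              ≡⟨ ∑℘-total₂ (λ x y t → 𝟙 (W? x y (t [ x ⇄ y ]))) ⟨
  ∑℘ (λ t → total (λ x → total (λ y → 𝟙 (W? x y (t [ x ⇄ y ])))))
                                                              ≤⟨ ∑℘-mono-≤ pairs≤R ⟩
  ∑℘ (λ t → 𝟙 (R? t))                                       ∎
  where
  open ≤-Reasoning

  ∑℘-total₂ : (f : Fin m → Fin m → Subset m → ℕ) →
    ∑℘ (λ s → total (λ x → total (λ y → f x y s))) ≡ total (λ x → total (λ y → ∑℘ (f x y)))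
  ∑℘-total₂ f = trans (∑℘-total (λ x s → total (λ y → f x y s))) (total-cong (λ x → ∑℘-total (f x)))

  P≤pairs : ∀ s → 𝟙 (P? s) ≤ total (λ x → total (λ y → 𝟙 (W? x y s)))
  P≤pairs s = 𝟙-≤ (P? s) λ Ps → let (x , y , Wxy) = witness Ps in begin
    1                                        ≡⟨ 𝟙-yes (W? x y s) Wxy ⟨
    𝟙 (W? x y s)                             ≤⟨ term≤total _ y ⟩
    total (λ y → 𝟙 (W? x y s))               ≤⟨ term≤total _ x ⟩
    total (λ x → total (λ y → 𝟙 (W? x y s))) ∎

  row : Subset m → Fin m → ℕ
  row t x = total (λ y → 𝟙 (W? x y (t [ x ⇄ y ])))

  row-witness : ∀ {t x} → 1 ≤ row t x → ∃ λ y → W x y (t [ x ⇄ y ])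
  row-witness {t} {x} 1≤row with total-positive _ 1≤row
  ... | y , 1≤𝟙 = y , 𝟙-witness (W? x y (t [ x ⇄ y ])) 1≤𝟙

  pairs≤R : ∀ t → total (row t) ≤ 𝟙 (R? t)
  pairs≤R t with 1 ≤? total (row t)
  ... | no  total≱1 = ≤-trans (≮⇒≥ total≱1) z≤n
  ... | yes total≥1 with total-positive (row t) total≥1
  ...   | _ , 1≤row = begin
    total (row t) ≤⟨ total-≤1 (row t) row≤1 rows-unique ⟩
    1             ≡⟨ 𝟙-yes (R? t) (W⇒R (proj₂ (row-witness 1≤row))) ⟨
    𝟙 (R? t)      ∎
    where
    row≤1 : ∀ x → row t x ≤ 1
    row≤1 x = total-≤1 _ (λ y → 𝟙≤1 (W? x y (t [ x ⇄ y ])))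
      (λ y y′ p q → proj₂ (W-unique (𝟙-witness (W? x y _) p) (𝟙-witness (W? x y′ _) q)))
    rows-unique : ∀ x x′ → 1 ≤ row t x → 1 ≤ row t x′ → x ≡ x′
    rows-unique x x′ p q = proj₁ (W-unique (proj₂ (row-witness p)) (proj₂ (row-witness q)))

-- Divisors of a sum of two parts

both-parts-divide⇒≡ : ∀ {p q} → p ∣ p + q → q ∣ p + q → p ≡ q
both-parts-divide⇒≡ {p} {q} p∣p+q q∣p+q =
  ∣-antisym (∣m+n∣m⇒∣n p∣p+q ∣-refl) (∣m+n∣m⇒∣n (subst (q ∣_) (+-comm p q) q∣p+q) ∣-refl)

¬∣-between-multiples : ∀ k {d T} → d ∣ T → k * d < T → T < suc k * d → ⊥
¬∣-between-multiples k {d} (divides r refl) kd<rd rd<[1+k]d =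
  <⇒≱ (*-cancelʳ-< d k r kd<rd) (s≤s⁻¹ (*-cancelʳ-< d r (suc k) rd<[1+k]d))

¬∣-close-parts : ∀ {p q} → p < q → q < 2 * p → ¬ (p ∣ p + q) × ¬ (q ∣ p + q)
¬∣-close-parts {zero}  {q}     _   ()
¬∣-close-parts {suc p} {q} p<q q<2p =
  (λ p∣ → ¬∣-between-multiples 2 p∣ (+-monoʳ-< (suc p) (subst (_< q) (sym (+-identityʳ (suc p))) p<q))
                                     (+-monoʳ-< (suc p) q<2p)) ,
  (λ q∣ → ¬∣-between-multiples 1 q∣ (subst (_< suc p + q) (sym (+-identityʳ q)) (m<n+m q z<s))
                                     (subst (suc p + q <_) (cong (q +_) (sym (+-identityʳ q))) (+-monoˡ-< q p<q)))

¬∣-below-half : ∀ {p q h g T} → p + q ≡ T → 2 * h ≡ T → h ≡ p + g → 0 < g → 6 * g < T →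
  ¬ (p ∣ T) × ¬ (q ∣ T)
¬∣-below-half {p} {q} {h} {g} refl 2h≡T h≡p+g 0<g 6g<T with q≡p+2g
  where
  expand : ∀ p g → 2 * (p + g) ≡ p + (p + 2 * g)
  expand = solve-∀
  q≡p+2g : q ≡ p + 2 * g
  q≡p+2g = +-cancelˡ-≡ p q (p + 2 * g) (trans (sym 2h≡T) (trans (cong (2 *_) h≡p+g) (expand p g)))
... | refl = ¬∣-close-parts (m<m+n p (*-monoʳ-< 2 0<g)) q<2p
  where
  split-6g : ∀ g → 6 * g ≡ 2 * (2 * g) + 2 * g
  split-6g = solve-∀
  regroup : ∀ p g → p + (p + 2 * g) ≡ 2 * p + 2 * g
  regroup = solve-∀
  2g<p : 2 * g < p
  2g<p = *-cancelˡ-< 2 (2 * g) p (+-cancelʳ-< (2 * g) (2 * (2 * g)) (2 * p)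
           (subst₂ _<_ (split-6g g) (regroup p g) 6g<T))
  q<2p : p + 2 * g < 2 * p
  q<2p = subst (p + 2 * g <_) (cong (p +_) (sym (+-identityʳ p))) (+-monoʳ-< p 2g<p)

¬∣-off-half : ∀ {p q h g T} → p + q ≡ T → 2 * h ≡ T → h ≡ p + g ⊎ p ≡ h + g → 0 < g → 6 * g < T →
  ¬ (p ∣ T) × ¬ (q ∣ T)
¬∣-off-half p+q≡T 2h≡T (inj₁ h≡p+g) 0<g 6g<T = ¬∣-below-half p+q≡T 2h≡T h≡p+g 0<g 6g<T
¬∣-off-half {p} {q} {h} {g} {T} p+q≡T 2h≡T (inj₂ p≡h+g) 0<g 6g<T =
  swap (¬∣-below-half (trans (+-comm q p) p+q≡T) 2h≡T h≡q+g 0<g 6g<T)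
  where
  regroup : ∀ h q g → h + (q + g) ≡ h + g + q
  regroup = solve-∀
  double : ∀ h → 2 * h ≡ h + h
  double = solve-∀
  h≡q+g : h ≡ q + g
  h≡q+g = sym (+-cancelˡ-≡ h (q + g) h (begin
    h + (q + g)  ≡⟨ regroup h q g ⟩
    h + g + q    ≡⟨ cong (_+ q) p≡h+g ⟨
    p + q        ≡⟨ p+q≡T ⟩
    T            ≡⟨ 2h≡T ⟨
    2 * h        ≡⟨ double h ⟩
    h + h        ∎))
    where open ≡-Reasoning

∣-factorial : ∀ {d N} → 1 ≤ d → d ≤ N → d ∣ N !
∣-factorial {suc d} _ d≤N = ∣-trans (m∣m*n (d !)) (m≤n⇒m!∣n! d≤N)

module UpperBound {n : ℕ} (a : Fin (2 * n) → ℕ) (isPos : IsPosSet (2 * n) a) (3≤n : 3 ≤ n) where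

  S : ℕ
  S = total a

  σ : Subset (2 * n) → ℕ
  σ = subsetSum a

  Divisor Balanced NeitherDivides : Subset (2 * n) → Set
  Divisor s        = ∣ s ∣ ≡ n × σ s ∣ S
  Balanced s       = ∣ s ∣ ≡ n × 2 * σ s ≡ S
  NeitherDivides s = ∣ s ∣ ≡ n × ¬ (σ s ∣ S) × ¬ (σ (∁ s) ∣ S)

  divisor? : Decidable Divisor
  divisor? s = (∣ s ∣ ≟ n) ×-dec (σ s ∣? S)

  balanced? : Decidable Balanced
  balanced? s = (∣ s ∣ ≟ n) ×-dec (2 * σ s ≟ S)

  neitherDivides? : Decidable NeitherDivides
  neitherDivides? s = (∣ s ∣ ≟ n) ×-dec ¬? (σ s ∣? S) ×-dec ¬? (σ (∁ s) ∣? S)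

  σ+σ∁ : ∀ s → σ s + σ (∁ s) ≡ S
  σ+σ∁ = subsetSum-∁ a

  ∣∣+∣∁∣≡n+n : ∀ s → ∣ s ∣ + ∣ ∁ s ∣ ≡ n + n
  ∣∣+∣∁∣≡n+n s = trans (∣∣+∣∁∣ s) (cong (n +_) (+-identityʳ n))

  ∣∁∣≡n : ∀ s → ∣ s ∣ ≡ n → ∣ ∁ s ∣ ≡ n
  ∣∁∣≡n s ∣s∣≡n = +-cancelˡ-≡ n _ n (trans (cong (_+ ∣ ∁ s ∣) (sym ∣s∣≡n)) (∣∣+∣∁∣≡n+n s))

  ∣∣≡n-from-∁ : ∀ s → ∣ ∁ s ∣ ≡ n → ∣ s ∣ ≡ n
  ∣∣≡n-from-∁ s ∣∁s∣≡n = +-cancelʳ-≡ n _ n (trans (cong (∣ s ∣ +_) (sym ∣∁s∣≡n)) (∣∣+∣∁∣≡n+n s))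

  both-divide⇒balanced : ∀ s → σ s ∣ S → σ (∁ s) ∣ S → 2 * σ s ≡ S
  both-divide⇒balanced s σs∣S σ∁s∣S = begin
    σ s + (σ s + 0)  ≡⟨ cong (σ s +_) (+-identityʳ (σ s)) ⟩
    σ s + σ s        ≡⟨ cong (σ s +_) (both-parts-divide⇒≡ (subst (σ s ∣_) (sym (σ+σ∁ s)) σs∣S)
                                                          (subst (σ (∁ s) ∣_) (sym (σ+σ∁ s)) σ∁s∣S)) ⟩
    σ s + σ (∁ s)    ≡⟨ σ+σ∁ s ⟩
    S                ∎
    where open ≡-Reasoning

  complement-pair-bound : ∀ s →
    𝟙 (divisor? s) + 𝟙 (divisor? (∁ s)) + 𝟙 (neitherDivides? s) ≤ 𝟙 (∣ s ∣ ≟ n) + 𝟙 (balanced? s)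
  complement-pair-bound s = by-size (∣ s ∣ ≟ n)
    where
    open ≤-Reasoning
    neither? = ¬? (σ s ∣? S) ×-dec ¬? (σ (∁ s) ∣? S)
    by-size : Dec (∣ s ∣ ≡ n) →
      𝟙 (divisor? s) + 𝟙 (divisor? (∁ s)) + 𝟙 (neitherDivides? s) ≤ 𝟙 (∣ s ∣ ≟ n) + 𝟙 (balanced? s)
    by-size (no ∣s∣≢n) = ≤-trans (≤-reflexive (cong₂ _+_
      (cong₂ _+_ (𝟙-×-no (∣ s ∣ ≟ n) (σ s ∣? S) ∣s∣≢n)
                 (𝟙-×-no (∣ ∁ s ∣ ≟ n) (σ (∁ s) ∣? S) (∣s∣≢n ∘ ∣∣≡n-from-∁ s)))
      (𝟙-×-no (∣ s ∣ ≟ n) neither? ∣s∣≢n))) z≤n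
    by-size (yes ∣s∣≡n) = begin
      𝟙 (divisor? s) + 𝟙 (divisor? (∁ s)) + 𝟙 (neitherDivides? s)
        ≡⟨ cong₂ _+_ (cong₂ _+_ (𝟙-×-yes (∣ s ∣ ≟ n) (σ s ∣? S) ∣s∣≡n)
                                (𝟙-×-yes (∣ ∁ s ∣ ≟ n) (σ (∁ s) ∣? S) (∣∁∣≡n s ∣s∣≡n)))
                     (𝟙-×-yes (∣ s ∣ ≟ n) neither? ∣s∣≡n) ⟩
      𝟙 (σ s ∣? S) + 𝟙 (σ (∁ s) ∣? S) + 𝟙 neither?
        ≤⟨ 𝟙-pair-bound (σ s ∣? S) (σ (∁ s) ∣? S) (2 * σ s ≟ S) (both-divide⇒balanced s) ⟩
      1 + 𝟙 (2 * σ s ≟ S)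
        ≡⟨ cong₂ _+_ (𝟙-yes (∣ s ∣ ≟ n) ∣s∣≡n) (𝟙-×-yes (∣ s ∣ ≟ n) (2 * σ s ≟ S) ∣s∣≡n) ⟨
      𝟙 (∣ s ∣ ≟ n) + 𝟙 (balanced? s) ∎

  a-injective : ∀ {i j} → a i ≡ a j → i ≡ j
  a-injective = proj₁ isPos

  a-<⇒≢ : ∀ {i j} → a i < a j → i ≢ j
  a-<⇒≢ aᵢ<aⱼ refl = <-irrefl refl aᵢ<aⱼ

  least-by-a : {P : Fin (2 * n) → Set} → Decidable P → ∃ P → ∃ λ i → P i × ∀ j → P j → a i ≤ a j
  least-by-a = least (λ i j → a i ≤ a j) (λ i j → ≤-total (a i) (a j)) ≤-trans

  greatest-by-a : {P : Fin (2 * n) → Set} → Decidable P → ∃ P → ∃ λ i → P i × ∀ j → P j → a j ≤ a i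
  greatest-by-a = least (λ i j → a j ≤ a i) (λ i j → ≤-total (a j) (a i)) (λ i≥j j≥k → ≤-trans j≥k i≥j)

  Adjacent : Fin (2 * n) → Fin (2 * n) → Set
  Adjacent x y = a x < a y × ∀ z → ¬ (a x < a z × a z < a y)

  Switchable : Subset (2 * n) → Fin (2 * n) → Fin (2 * n) → Set
  Switchable s x y = Adjacent x y × lookup s x ≢ lookup s y × 6 * (a y ∸ a x) < S

  FirstSwitch : Fin (2 * n) → Fin (2 * n) → Subset (2 * n) → Set
  FirstSwitch x y s = Balanced s × Switchable s x y × ∀ x′ y′ → Switchable s x′ y′ → a x ≤ a x′

  adjacent? : ∀ x y → Dec (Adjacent x y)
  adjacent? x y = (a x <? a y) ×-dec all? (λ z → ¬? ((a x <? a z) ×-dec (a z <? a y)))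

  switchable? : ∀ s x y → Dec (Switchable s x y)
  switchable? s x y = adjacent? x y ×-dec ¬? (lookup s x Bool.≟ lookup s y) ×-dec (6 * (a y ∸ a x) <? S)

  firstSwitch? : ∀ x y → Decidable (FirstSwitch x y)
  firstSwitch? x y s = balanced? s ×-dec switchable? s x y ×-dec
    all? (λ x′ → all? (λ y′ → switchable? s x′ y′ →-dec (a x ≤? a x′)))

  adjacent⇒≢ : ∀ {x y} → Adjacent x y → x ≢ y
  adjacent⇒≢ (aₓ<aᵧ , _) = a-<⇒≢ aₓ<aᵧ

  adjacent-unique : ∀ {x y y′} → Adjacent x y → Adjacent x y′ → y ≡ y′
  adjacent-unique {x} {y} {y′} (aₓ<aᵧ , y-next) (aₓ<aᵧ′ , y′-next) with <-cmp (a y) (a y′)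
  ... | tri< aᵧ<aᵧ′ _ _ = contradiction (aₓ<aᵧ , aᵧ<aᵧ′) (y′-next y)
  ... | tri≈ _ aᵧ≡aᵧ′ _ = a-injective aᵧ≡aᵧ′
  ... | tri> _ _ aᵧ′<aᵧ = contradiction (aₓ<aᵧ′ , aᵧ′<aᵧ) (y-next y′)

  balanced-∁ : ∀ {s} → Balanced s → Balanced (∁ s)
  balanced-∁ {s} (∣s∣≡n , 2σs≡S) = ∣∁∣≡n s ∣s∣≡n , trans (cong (2 *_) σ∁s≡σs) 2σs≡S
    where
    σ∁s≡σs : σ (∁ s) ≡ σ s
    σ∁s≡σs = +-cancelˡ-≡ (σ s) _ _ (trans (σ+σ∁ s) (trans (sym 2σs≡S) (cong (σ s +_) (+-identityʳ (σ s)))))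

  6*≤S : ∀ {s v} → Balanced s → (∀ j → lookup s j ≡ inside → v ≤ a j) → 6 * v ≤ S
  6*≤S {s} {v} (∣s∣≡n , 2σs≡S) v≤s = begin
    6 * v        ≡⟨ split v ⟩
    2 * (3 * v)  ≤⟨ *-monoʳ-≤ 2 (*-monoˡ-≤ v 3≤n) ⟩
    2 * (n * v)  ≡⟨ cong (λ k → 2 * (k * v)) ∣s∣≡n ⟨
    2 * (∣ s ∣ * v) ≤⟨ *-monoʳ-≤ 2 (∣∣*≤subsetSum a s v≤s) ⟩
    2 * σ s      ≡⟨ 2σs≡S ⟩
    S            ∎
    where
    open ≤-Reasoning
    split : ∀ v → 6 * v ≡ 2 * (3 * v)
    split = solve-∀

  6*≤S-side : ∀ {s v} → Balanced s → ∀ b → (∀ j → lookup s j ≡ b → v ≤ a j) → 6 * v ≤ S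
  6*≤S-side bal         true  v≤side = 6*≤S bal v≤side
  6*≤S-side {s} {v} bal false v≤side = 6*≤S (balanced-∁ bal) λ j ∁sⱼ →
    v≤side j (not-injective (trans (sym (lookup-map j not s)) ∁sⱼ))

  both-memberships : ∀ {s} → Balanced s → ∀ c → ∃ λ j → lookup s j ≢ c
  both-memberships {s} (∣s∣≡n , _) c with all? (λ j → lookup s j Bool.≟ c)
  ... | no ¬all≡c = Fin.¬∀⟶∃¬ _ _ (λ j → lookup s j Bool.≟ c) ¬all≡c
  ... | yes all≡c = contradiction (∣∣-constant s c all≡c) (not-constant c)
    where
    n≢0 : n ≢ 0
    n≢0 n≡0 = contradiction (subst (3 ≤_) n≡0 3≤n) λ ()
    not-constant : ∀ b → ∣ s ∣ ≢ (if b then 2 * n else 0)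
    not-constant true  ∣s∣≡2n = n≢0 (sym (trans (+-cancelˡ-≡ n 0 (n + 0)
                                  (trans (+-identityʳ n) (trans (sym ∣s∣≡n) ∣s∣≡2n))) (+-identityʳ n)))
    not-constant false ∣s∣≡0  = n≢0 (trans (sym ∣s∣≡n) ∣s∣≡0)

  -- With u the least element and w the least one on the other side, the element just below w is on
  -- u's side, and the n elements on w's side give 6 · a w ≤ S.
  switchable-before : ∀ {s u w} → Balanced s → (∀ j → a u ≤ a j) → lookup s w ≢ lookup s u →
    (∀ j → lookup s j ≢ lookup s u → a w ≤ a j) → ∃ λ z → Switchable s z w
  switchable-before {s} {u} {w} bal u-least sʷ≢sᵘ w-least
    with greatest-by-a (λ j → a j <? a w) (u , aᵘ<aʷ)
    where
    aᵘ<aʷ : a u < a w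
    aᵘ<aʷ = ≤∧≢⇒< (u-least w) (λ aᵘ≡aʷ → sʷ≢sᵘ (cong (lookup s) (sym (a-injective aᵘ≡aʷ))))
  ... | z , aᶻ<aʷ , z-greatest = z , (aᶻ<aʷ , nothing-between) , sᶻ≢sʷ , gap
    where
    nothing-between : ∀ v → ¬ (a z < a v × a v < a w)
    nothing-between v (aᶻ<aᵛ , aᵛ<aʷ) = <⇒≱ aᶻ<aᵛ (z-greatest v aᵛ<aʷ)
    sᶻ≡sᵘ : lookup s z ≡ lookup s u
    sᶻ≡sᵘ with lookup s z Bool.≟ lookup s u
    ... | yes sᶻ≡sᵘ = sᶻ≡sᵘ
    ... | no  sᶻ≢sᵘ = contradiction (w-least z sᶻ≢sᵘ) (<⇒≱ aᶻ<aʷ)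
    sᶻ≢sʷ : lookup s z ≢ lookup s w
    sᶻ≢sʷ sᶻ≡sʷ = sʷ≢sᵘ (trans (sym sᶻ≡sʷ) sᶻ≡sᵘ)
    6aʷ≤S : 6 * a w ≤ S
    6aʷ≤S = 6*≤S-side bal (not (lookup s u)) λ j sⱼ≡¬sᵘ → w-least j (λ sⱼ≡sᵘ → not-¬ sⱼ≡sᵘ sⱼ≡¬sᵘ)
    gap : 6 * (a w ∸ a z) < S
    gap = <-≤-trans (*-monoʳ-< 6 (∸-monoʳ-< (proj₂ isPos z) (<⇒≤ aᶻ<aʷ))) 6aʷ≤S

  switchable-exists : ∀ {s} → Balanced s → ∃ λ x → ∃ λ y → Switchable s x y
  switchable-exists {s} bal with least-by-a (λ _ → yes tt) (fromℕ< 0<2n , tt)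
    where
    0<2n : 0 < 2 * n
    0<2n = <-≤-trans z<s (≤-trans 3≤n (m≤m+n n (n + 0)))
  ... | u , _ , u-least with least-by-a (λ j → ¬? (lookup s j Bool.≟ lookup s u)) (both-memberships bal (lookup s u))
  ... | w , sʷ≢sᵘ , w-least with switchable-before bal (λ j → u-least j tt) sʷ≢sᵘ w-least
  ... | z , switch = z , w , switch

  firstSwitch-exists : ∀ {s} → Balanced s → ∃ λ x → ∃ λ y → FirstSwitch x y s
  firstSwitch-exists {s} bal with least-by-a (λ x → any? (switchable? s x)) (switchable-exists bal)
  ... | x , (y , switch) , x-least = x , y , bal , switch , λ x′ y′ switch′ → x-least x′ (y′ , switch′)

  switch⇒neitherDivides : ∀ {t x y} → Balanced (t [ x ⇄ y ]) → Switchable (t [ x ⇄ y ]) x y → NeitherDivides t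
  switch⇒neitherDivides {t} {x} {y} (∣s∣≡n , 2σs≡S) (adj@(aₓ<aᵧ , _) , sₓ≢sᵧ , gap) =
    trans (sym (∣⇄∣ t x≢y)) ∣s∣≡n ,
    ¬∣-off-half (σ+σ∁ t) 2σs≡S
      (subsetSum-⇄-shift a t x≢y (<⇒≤ aₓ<aᵧ) (⇄-distinct t x≢y sₓ≢sᵧ)) (m<n⇒0<n∸m aₓ<aᵧ) gap
    where
    x≢y : x ≢ y
    x≢y = adjacent⇒≢ adj

  balanced⇒σ≡ : ∀ {s s′} → Balanced s → Balanced s′ → σ s ≡ σ s′
  balanced⇒σ≡ {s} {s′} (_ , 2σs≡S) (_ , 2σs′≡S) = *-cancelˡ-≡ (σ s) (σ s′) 2 (trans 2σs≡S (sym 2σs′≡S))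

  no-earlier-switch : ∀ {t x₁ y₁ x₂ y₂} → FirstSwitch x₁ y₁ (t [ x₁ ⇄ y₁ ]) → FirstSwitch x₂ y₂ (t [ x₂ ⇄ y₂ ]) →
    ¬ a x₁ < a x₂
  no-earlier-switch {t} {x₁} {y₁} {x₂} {y₂}
    (bal₁ , (adj₁@(a₁<a₁′ , y₁-next) , s₁-differ , gap₁) , _) (bal₂ , (adj₂@(a₂<a₂′ , _) , s₂-differ , _) , first₂) a₁<a₂
    with y₁ Fin.≟ x₂
  ... | yes refl = <-irrefl (subsetSum-⇄-chain a t (adjacent⇒≢ adj₁) (adjacent⇒≢ adj₂)
                               (⇄-distinct t (adjacent⇒≢ adj₁) s₁-differ) (⇄-distinct t (adjacent⇒≢ adj₂) s₂-differ)
                               (balanced⇒σ≡ bal₁ bal₂))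
                            (<-trans a₁<a₁′ a₂<a₂′)
  ... | no y₁≢x₂ = <⇒≱ a₁<a₂ (first₂ x₁ y₁ (adj₁ , s₂-differ₁ , gap₁))
    where
    a₁′≤a₂ : a y₁ ≤ a x₂
    a₁′≤a₂ = ≮⇒≥ (λ a₂<a₁′ → y₁-next x₂ (a₁<a₂ , a₂<a₁′))
    s₂x₁≡tx₁ : lookup (t [ x₂ ⇄ y₂ ]) x₁ ≡ lookup t x₁
    s₂x₁≡tx₁ = ⇄-lookup-other t (a-<⇒≢ a₁<a₂) (a-<⇒≢ (<-trans a₁<a₂ a₂<a₂′))
    s₂y₁≡ty₁ : lookup (t [ x₂ ⇄ y₂ ]) y₁ ≡ lookup t y₁
    s₂y₁≡ty₁ = ⇄-lookup-other t y₁≢x₂ (a-<⇒≢ (≤-<-trans a₁′≤a₂ a₂<a₂′))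
    s₂-differ₁ : lookup (t [ x₂ ⇄ y₂ ]) x₁ ≢ lookup (t [ x₂ ⇄ y₂ ]) y₁
    s₂-differ₁ eq = ⇄-distinct t (adjacent⇒≢ adj₁) s₁-differ (trans (sym s₂x₁≡tx₁) (trans eq s₂y₁≡ty₁))

  firstSwitch-unique : ∀ {t x₁ y₁ x₂ y₂} → FirstSwitch x₁ y₁ (t [ x₁ ⇄ y₁ ]) → FirstSwitch x₂ y₂ (t [ x₂ ⇄ y₂ ]) →
    x₁ ≡ x₂ × y₁ ≡ y₂
  firstSwitch-unique {x₁ = x₁} {x₂ = x₂} first₁ first₂ with <-cmp (a x₁) (a x₂)
  ... | tri< a₁<a₂ _ _ = contradiction a₁<a₂ (no-earlier-switch first₁ first₂)
  ... | tri> _ _ a₂<a₁ = contradiction a₂<a₁ (no-earlier-switch first₂ first₁)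
  ... | tri≈ _ a₁≡a₂ _ with a-injective a₁≡a₂
  ...   | refl = refl , adjacent-unique (proj₁ (proj₁ (proj₂ first₁))) (proj₁ (proj₁ (proj₂ first₂)))

  balanced≤neitherDivides : ∑℘ (λ s → 𝟙 (balanced? s)) ≤ ∑℘ (λ s → 𝟙 (neitherDivides? s))
  balanced≤neitherDivides = ∑℘-≤-via-⇄ balanced? neitherDivides? firstSwitch? firstSwitch-exists
    (λ (bal , switch , _) → switch⇒neitherDivides bal switch) firstSwitch-unique

  twice-divisors≤ : 2 * ∑℘ (λ s → 𝟙 (divisor? s)) ≤ 2 * n C n
  twice-divisors≤ = +-cancelʳ-≤ (∑℘ ND) (2 * ∑℘ D) (2 * n C n) (begin
    2 * ∑℘ D + ∑℘ ND                              ≡⟨ cong (λ k → ∑℘ D + k + ∑℘ ND)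
                                                         (trans (+-identityʳ (∑℘ D)) (sym (∑℘-∘∁ D))) ⟩
    ∑℘ D + ∑℘ (D ∘ ∁) + ∑℘ ND                     ≡⟨ cong (_+ ∑℘ ND) (∑℘-distrib-+ D (D ∘ ∁)) ⟨
    ∑℘ (λ s → D s + D (∁ s)) + ∑℘ ND              ≡⟨ ∑℘-distrib-+ (λ s → D s + D (∁ s)) ND ⟨
    ∑℘ (λ s → D s + D (∁ s) + ND s)               ≤⟨ ∑℘-mono-≤ complement-pair-bound ⟩
    ∑℘ (λ s → N s + B s)                          ≡⟨ ∑℘-distrib-+ N B ⟩
    ∑℘ N + ∑℘ B                                   ≤⟨ +-mono-≤ (≤-reflexive (∑℘-card (2 * n) n)) balanced≤neitherDivides ⟩
    2 * n C n + ∑℘ ND                             ∎)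
    where
    open ≤-Reasoning
    D N B ND : Subset (2 * n) → ℕ
    D s  = 𝟙 (divisor? s)
    N s  = 𝟙 (∣ s ∣ ≟ n)
    B s  = 𝟙 (balanced? s)
    ND s = 𝟙 (neitherDivides? s)

  dk≤half : dk n a ≤ (2 * n C n) / 2
  dk≤half = begin
    dk n a                           ≡⟨ length-filter-allSubsets divisor? ⟩
    ∑℘ (λ s → 𝟙 (divisor? s))        ≡⟨ m*n/n≡m (∑℘ (λ s → 𝟙 (divisor? s))) 2 ⟨
    ∑℘ (λ s → 𝟙 (divisor? s)) * 2 / 2 ≤⟨ /-monoˡ-≤ 2 (subst (_≤ 2 * n C n) (*-comm 2 (∑℘ (λ s → 𝟙 (divisor? s)))) twice-divisors≤) ⟩
    (2 * n C n) / 2                  ∎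
    where open ≤-Reasoning

module Extremal (k : ℕ) where

  small : Fin k → ℕ
  small i = suc (toℕ i)

  B F M : ℕ
  B = total small
  F = suc (2 * B) !
  -- F = M + B is a multiple of every nonzero subset sum of {1, …, k}, and M > B.
  M = F ∸ B

  extremal : Fin (suc k) → ℕ
  extremal zero    = M
  extremal (suc i) = small i

  1+2B≤F : suc (2 * B) ≤ F
  1+2B≤F = ∣⇒≤ {{suc (2 * B) !≢0}} (∣-factorial z<s ≤-refl)

  M+B≡F : M + B ≡ F
  M+B≡F = m∸n+n≡m (≤-trans (m≤m+n B (B + 0)) (≤-trans (n≤1+n (2 * B)) 1+2B≤F))

  B<M : B < M
  B<M = +-cancelʳ-< B B M (subst (B + B <_) (sym M+B≡F)
          (<-≤-trans (s≤s (≤-reflexive (cong (B +_) (sym (+-identityʳ B))))) 1+2B≤F))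

  small<M : ∀ i → small i < M
  small<M i = ≤-<-trans (term≤total small i) B<M

  isPosSet : IsPosSet (suc k) extremal
  isPosSet = injective , positive
    where
    injective : ∀ {i j} → extremal i ≡ extremal j → i ≡ j
    injective {zero}  {zero}  _ = refl
    injective {zero}  {suc j} M≡ = contradiction (sym M≡) (<⇒≢ (small<M j))
    injective {suc i} {zero}  ≡M = contradiction ≡M (<⇒≢ (small<M i))
    injective {suc i} {suc j} eq = cong suc (Fin.toℕ-injective (suc-injective eq))
    positive : ∀ i → 0 < extremal i
    positive zero    = ≤-<-trans z≤n B<M
    positive (suc i) = z<s

  1≤subsetSum-small : ∀ {t} → 1 ≤ ∣ t ∣ → 1 ≤ subsetSum small t
  1≤subsetSum-small {t} 1≤∣t∣ = ≤-trans (≤-trans 1≤∣t∣ (≤-reflexive (sym (*-identityʳ ∣ t ∣))))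
                          (∣∣*≤subsetSum small t (λ _ _ → z<s))

  dk-extremal : ∀ n′ → suc n′ ≤ k → dk (suc n′) extremal ≡ k C suc n′
  dk-extremal n′ n≤k = begin
    dk (suc n′) extremal                            ≡⟨ length-filter-allSubsets divisor? ⟩
    ∑℘ (λ t → 𝟙 (divisor? (inside ∷ t))) + ∑℘ (λ t → 𝟙 (divisor? (outside ∷ t)))
                                                    ≡⟨ cong₂ _+_ (trans (∑℘-cong with-M) (∑℘-zero k))
                                                                 (trans (∑℘-cong without-M) (∑℘-card k (suc n′))) ⟩
    0 + k C suc n′                                  ∎
    where
    open ≡-Reasoning
    divisor? : (s : Subset (suc k)) → Dec (∣ s ∣ ≡ suc n′ × subsetSum extremal s ∣ total extremal)
    divisor? s = (∣ s ∣ ≟ suc n′) ×-dec (subsetSum extremal s ∣? total extremal)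

    with-M : ∀ t → 𝟙 (divisor? (inside ∷ t)) ≡ 0
    with-M t = 𝟙-no (divisor? (inside ∷ t)) λ (1+∣t∣≡1+n′ , M+σ∣M+B) →
      ¬∣-between-multiples 1 M+σ∣M+B (M+σ<M+B (σ<B (suc-injective 1+∣t∣≡1+n′))) M+B<2[M+σ]
      where
      σ = subsetSum small t
      M+σ<M+B : σ < B → 1 * (M + σ) < M + B
      M+σ<M+B σ<B = subst (_< M + B) (sym (+-identityʳ (M + σ))) (+-monoʳ-< M σ<B)
      M+B<2[M+σ] : M + B < 2 * (M + σ)
      M+B<2[M+σ] = <-≤-trans (+-monoʳ-< M B<M)
        (+-mono-≤ (m≤m+n M σ) (≤-trans (m≤m+n M σ) (≤-reflexive (sym (+-identityʳ (M + σ))))))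
      σ<B : ∣ t ∣ ≡ n′ → σ < B
      σ<B ∣t∣≡n′ = subst (σ <_) (subsetSum-∁ small t)
        (subst (_< σ + subsetSum small (∁ t)) (+-identityʳ σ) (+-monoʳ-< σ (1≤subsetSum-small 1≤∣∁t∣)))
        where
        1≤∣∁t∣ : 1 ≤ ∣ ∁ t ∣
        1≤∣∁t∣ = +-cancelˡ-< n′ 0 ∣ ∁ t ∣ (subst₂ _<_ (sym (+-identityʳ n′))
                   (trans (sym (∣∣+∣∁∣ t)) (cong (_+ ∣ ∁ t ∣) ∣t∣≡n′)) n≤k)

    without-M : ∀ t → 𝟙 (divisor? (outside ∷ t)) ≡ 𝟙 (∣ t ∣ ≟ suc n′)
    without-M t = 𝟙-×-implied (∣ t ∣ ≟ suc n′) (subsetSum small t ∣? M + B) λ ∣t∣≡n →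
      subst (subsetSum small t ∣_) (sym M+B≡F)
        (∣-factorial (1≤subsetSum-small (subst (1 ≤_) (sym ∣t∣≡n) (s≤s z≤n)))
                     (≤-trans (subsetSum≤total small t) (≤-trans (m≤m+n B (B + 0)) (n≤1+n (2 * B)))))

half-central-binomial : ∀ {n′ k} → k ≡ n′ + suc n′ → (suc k C suc n′) / 2 ≡ k C suc n′
half-central-binomial {n′} {k} refl = begin
  (suc k C suc n′) / 2             ≡⟨ cong (_/ 2) (nCk+nC[k+1]≡[n+1]C[k+1] k n′) ⟨
  (k C n′ + k C suc n′) / 2        ≡⟨ cong (λ c → (c + k C suc n′) / 2) symmetric ⟩
  (k C suc n′ + k C suc n′) / 2    ≡⟨ cong (_/ 2) (cong (k C suc n′ +_) (+-identityʳ (k C suc n′))) ⟨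
  (2 * (k C suc n′)) / 2           ≡⟨ cong (_/ 2) (*-comm 2 (k C suc n′)) ⟩
  ((k C suc n′) * 2) / 2           ≡⟨ m*n/n≡m (k C suc n′) 2 ⟩
  k C suc n′                       ∎
  where
  open ≡-Reasoning
  symmetric : k C n′ ≡ k C suc n′
  symmetric = trans (nCk≡nC[n∸k] (m≤m+n n′ (suc n′))) (cong (k C_) (m+n∸m≡n n′ (suc n′)))

mainTheorem12 : (n : ℕ) → 3 ≤ n →
    ((a : Fin (2 * n) → ℕ) → IsPosSet (2 * n) a → dk n a ≤ ((2 * n) C n) / 2)
    × Σ (Fin (2 * n) → ℕ) (λ a → IsPosSet (2 * n) a × dk n a ≡ ((2 * n) C n) / 2)
mainTheorem12 (suc n′) 3≤n =
  (λ a isPos → UpperBound.dk≤half a isPos 3≤n) ,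
  extremal , isPosSet , trans (dk-extremal n′ n≤k) (sym (half-central-binomial k≡n′+n))
  where
  open Extremal (n′ + (suc n′ + 0))
  k≡n′+n : n′ + (suc n′ + 0) ≡ n′ + suc n′
  k≡n′+n = cong (n′ +_) (+-identityʳ (suc n′))
  n≤k : suc n′ ≤ n′ + (suc n′ + 0)
  n≤k = ≤-trans (m≤n+m (suc n′) n′) (≤-reflexive (sym k≡n′+n))
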